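{- Let $G$ be an unbalanced split graph (considered as a labeled graph) with ABC-partition $V(G)=A\cup B\cup C$. If $G$ is an NG-1 graph, then the KS-partitions of $G$ are exactly: $K=A\cup B$, $S=C$ (which is the unique $K$-max partition), and $K=(A\cup B)\setminus\{a\}$, $S=C\cup\{a\}$ for each $a\in A$ (these are $S$-max). If $G$ is an NG-2 graph, then the KS-partitions of $G$ are exactly: $K=B$, $S=A\cup C$ (which is the unique $S$-max partition), and $K=B\cup\{a\}$, $S=(A\cup C)\setminus\{a\}$ for each $a\in A$ (these are $K$-max).
   Context: Graphs are finite and simple; $\chi,\omega,\alpha$ denote chromatic number, clique number and independence number. A graph $G$ is an NG-graph if $\chi(G)+\chi(\overline{G})=|V(G)|+1$. The ABC-partition of $V(G)$ is $A=\{v:\deg(v)=\chi(G)-1\}$, $B=\{v:\deg(v)>\chi(G)-1\}$, $C=\{v:\deg(v)<\chi(G)-1\}$. An NG-graph is NG-1 if $G[A]$ is a clique and NG-2 if $G[A]$ is a stable set. A KS-partition of a graph is a partition $V(G)=K\cup S$ with $K$ a clique and $S$ a stable set; a split graph is a graph having a KS-partition. A KS-partition is $K$-max if $|K|=\omega(G)$ and $S$-max if $|S|=\alpha(G)$. A split graph is balanced if it has a KS-partition that is both $K$-max and $S$-max, and unbalanced otherwise. -}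

module Defs where

open import Data.Nat using (ℕ; zero; suc; _+_; _≤_; _<_; _∸_)
open import Data.Nat.Properties using () renaming (_≟_ to _≟ℕ_; _<?_ to _<?ℕ_)
open import Data.Bool using (Bool; true; false; not; _∧_)
open import Data.Fin using (Fin; _≟_)
open import Data.Fin.Subset using (Subset; _∈_; _∉_; ∣_∣)
open import Data.Vec using (tabulate)
open import Data.Product using (Σ; _×_; ∃)
open import Data.Sum using (_⊎_)
open import Data.Empty using (⊥)
open import Relation.Nullary using (¬_)
open import Relation.Nullary.Decidable using (⌊_⌋)
open import Relation.Binary.PropositionalEquality using (_≡_; _≢_)

record Graph : Set where
  field
    n      : ℕ
    adj    : Fin n → Fin n → Bool
    adj-sym    : ∀ u v → adj u v ≡ adj v u
    adj-irrefl : ∀ v → adj v v ≡ false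
open Graph public

compl : Graph → Graph
compl G = record
  { n = n G
  ; adj = λ u v → not (adj G u v) ∧ not ⌊ u ≟ v ⌋
  ; adj-sym = symc
  ; adj-irrefl = irr }
  where
  open import Relation.Binary.PropositionalEquality using (refl; cong₂; sym)
  open import Relation.Nullary using (yes; no)
  open import Data.Empty using (⊥-elim)
  open import Data.Bool.Properties using (∧-zeroʳ)
  symc : ∀ u v → (not (adj G u v) ∧ not ⌊ u ≟ v ⌋) ≡ (not (adj G v u) ∧ not ⌊ v ≟ u ⌋)
  symc u v with u ≟ v | v ≟ u
  ... | yes _ | yes _ rewrite adj-sym G u v = refl
  ... | no _  | no _  rewrite adj-sym G u v = refl
  ... | yes p | no q  = ⊥-elim (q (sym p))
  ... | no p  | yes q = ⊥-elim (p (sym q))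
  irr : ∀ v → (not (adj G v v) ∧ not ⌊ v ≟ v ⌋) ≡ false
  irr v with v ≟ v
  ... | yes _ = ∧-zeroʳ (not (adj G v v))
  ... | no ¬p = ⊥-elim (¬p refl)

deg : (G : Graph) → Fin (n G) → ℕ
deg G v = ∣ tabulate (adj G v) ∣

Colorable : Graph → ℕ → Set
Colorable G k = Σ (Fin (n G) → Fin k) λ c →
  ∀ u v → adj G u v ≡ true → c u ≢ c v

IsChromaticNumber : Graph → ℕ → Set
IsChromaticNumber G k = Colorable G k × (∀ j → Colorable G j → k ≤ j)

IsClique : (G : Graph) → Subset (n G) → Set
IsClique G X = ∀ u v → u ∈ X → v ∈ X → u ≢ v → adj G u v ≡ true

IsStable : (G : Graph) → Subset (n G) → Set
IsStable G X = ∀ u v → u ∈ X → v ∈ X → adj G u v ≡ false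

IsCliqueNumber : Graph → ℕ → Set
IsCliqueNumber G w = (∃ λ X → IsClique G X × ∣ X ∣ ≡ w)
                   × (∀ X → IsClique G X → ∣ X ∣ ≤ w)

IsIndependenceNumber : Graph → ℕ → Set
IsIndependenceNumber G a = (∃ λ X → IsStable G X × ∣ X ∣ ≡ a)
                         × (∀ X → IsStable G X → ∣ X ∣ ≤ a)

IsNG : (G : Graph) → ℕ → Set
IsNG G k = IsChromaticNumber G k ×
  (∃ λ l → IsChromaticNumber (compl G) l × k + l ≡ suc (n G))

-- ABC-partition relative to k = χ(G)
setA setB setC : (G : Graph) → ℕ → Subset (n G)
setA G k = tabulate λ v → ⌊ deg G v ≟ℕ k ∸ 1 ⌋
setB G k = tabulate λ v → ⌊ k ∸ 1 <?ℕ deg G v ⌋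
setC G k = tabulate λ v → ⌊ deg G v <?ℕ k ∸ 1 ⌋

IsNG1 IsNG2 : (G : Graph) → ℕ → Set
IsNG1 G k = IsNG G k × IsClique G (setA G k)
IsNG2 G k = IsNG G k × IsStable G (setA G k)

IsKSPartition : (G : Graph) → Subset (n G) → Subset (n G) → Set
IsKSPartition G K S = (∀ v → v ∈ K ⊎ v ∈ S) × (∀ v → v ∈ K → v ∈ S → ⊥)
                    × IsClique G K × IsStable G S

IsSplit : Graph → Set
IsSplit G = ∃ λ K → ∃ λ S → IsKSPartition G K S

-- with w = ω(G), a = α(G)
KMax : (G : Graph) → ℕ → Subset (n G) → Subset (n G) → Set
KMax G w K S = IsKSPartition G K S × ∣ K ∣ ≡ w

SMax : (G : Graph) → ℕ → Subset (n G) → Subset (n G) → Set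
SMax G a K S = IsKSPartition G K S × ∣ S ∣ ≡ a

IsBalanced : (G : Graph) → ℕ → ℕ → Set
IsBalanced G w a = IsSplit G × (∃ λ K → ∃ λ S → KMax G w K S × SMax G a K S)

IsUnbalanced : (G : Graph) → ℕ → ℕ → Set
IsUnbalanced G w a = IsSplit G × ¬ (∃ λ K → ∃ λ S → KMax G w K S × SMax G a K S)

module Submission where

-- A
-- partition (K, S) is K-max iff no vertex of S is adjacent to all of K, and
-- S-max iff every vertex of K has a neighbour in S; otherwise one vertex can
-- be moved across, which yields a K-max (resp. S-max) partition.  Both
-- directions rest on counting: a clique meets S at most once and a stable
-- set meets K at most once, so they inject into K resp. S.  Colouring every
-- vertex of S like one of its non-neighbours in a K-max clique K shows
-- χ(G) = ω(G).  If G is unbalanced, every K-max partition has a vertex of K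
-- without neighbours in S and every S-max partition a vertex of S adjacent to
-- all of K; hence ω(G) = d + 1 where d = |K| for any S-max partition, and
-- A, B, C are the vertices of degree = d, > d, < d.

open import Defs
open import Data.Bool using (Bool; true; false; not)
open import Data.Bool.Properties using (T-≡; ¬-not; not-involutive) renaming (_≟_ to _≟ᵇ_)
open import Data.Empty using (⊥; ⊥-elim)
open import Data.Fin using (Fin; zero; suc; _≟_)
open import Data.Fin.Properties using (any?; all?; suc-injective; 0≢1+n)
open import Data.Fin.Subset using (Subset; _∈_; _∉_; _⊆_; _∪_; _─_; _-_; ⁅_⁆; ∣_∣; ⊤) renaming (⊥ to ∅)
open import Data.Fin.Subset.Properties
  using (_∈?_; x∈p∪q⁺; x∈p∪q⁻; x∈⁅x⁆; x∈⁅y⁆⇒x≡y; x∈p∧x≢y⇒x∈p-y; p─q⊆p; ∪-identityʳ; p─⊥≡p;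
         ⊆-antisym; p⊆q⇒∣p∣≤∣q∣; p⊂q⇒∣p∣<∣q∣; x∈p⇒∣p-x∣<∣p∣; ∣⊤∣≡n; ∈⊤)
open import Data.Nat using (ℕ; _≤_; _<_; z≤n; s≤s) renaming (suc to 1+)
open import Data.Nat.Properties
  using (≤-trans; ≤-reflexive; ≤-antisym; ≤-pred; <⇒≤; <⇒≱; <-irrefl; m≤n⇒m<n∨m≡n)
  renaming (_≟_ to _≟ℕ_; _<?_ to _<?ℕ_; suc-injective to 1+-injective)
open import Data.Product using (∃; _×_; _,_; proj₁; proj₂)
open import Data.Sum using (_⊎_; inj₁; inj₂; [_,_]; [_,_]′) renaming (map to ⊎-map; swap to ⊎-swap)
open import Data.Vec using (_∷_; []; tabulate; here; there)
open import Data.Vec.Properties using (lookup∘tabulate; []=⇒lookup; lookup⇒[]=)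
open import Function using (id; _∘_)
open import Function.Bundles using (_⇔_; mk⇔; Equivalence)
open import Relation.Nullary using (yes; no)
open import Relation.Nullary.Decidable using (⌊_⌋; toWitness; fromWitness; _×-dec_; _→-dec_)
open import Relation.Unary using (Pred; Decidable)
open import Relation.Binary.PropositionalEquality using (_≡_; _≢_; refl; sym; trans; cong; subst)

private
  variable
    m : ℕ

true≢false : true ≢ false
true≢false ()

∈-tabulate⁺ : (f : Fin m → Bool) {v : Fin m} → f v ≡ true → v ∈ tabulate f
∈-tabulate⁺ f {v} fv = lookup⇒[]= v (tabulate f) (trans (lookup∘tabulate f v) fv)

∈-tabulate⁻ : (f : Fin m → Bool) {v : Fin m} → v ∈ tabulate f → f v ≡ true
∈-tabulate⁻ f {v} v∈ = trans (sym (lookup∘tabulate f v)) ([]=⇒lookup v∈)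

∈-decided⁺ : ∀ {p} {P : Pred (Fin m) p} (P? : Decidable P) {v : Fin m} →
             P v → v ∈ tabulate (λ u → ⌊ P? u ⌋)
∈-decided⁺ P? pv = ∈-tabulate⁺ _ (Equivalence.to T-≡ (fromWitness pv))

∈-decided⁻ : ∀ {p} {P : Pred (Fin m) p} (P? : Decidable P) {v : Fin m} →
             v ∈ tabulate (λ u → ⌊ P? u ⌋) → P v
∈-decided⁻ P? v∈ = toWitness (Equivalence.from T-≡ (∈-tabulate⁻ _ v∈))

x∉p-x : (p : Subset m) (x : Fin m) → x ∉ p - x
x∉p-x (_ ∷ p) zero    ()
x∉p-x (_ ∷ p) (suc x) (there x∈) = x∉p-x p x x∈

x∈p-y⇒x≢y : (p : Subset m) {x y : Fin m} → x ∈ p - y → x ≢ y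
x∈p-y⇒x≢y p {x} x∈ refl = x∉p-x p x x∈

∣p∪⁅x⁆∣≡1+∣p∣ : (p : Subset m) (x : Fin m) → x ∉ p → ∣ p ∪ ⁅ x ⁆ ∣ ≡ 1+ ∣ p ∣
∣p∪⁅x⁆∣≡1+∣p∣ (false ∷ p) zero    _   = cong 1+ (cong ∣_∣ (∪-identityʳ p))
∣p∪⁅x⁆∣≡1+∣p∣ (true  ∷ p) zero    x∉p = ⊥-elim (x∉p here)
∣p∪⁅x⁆∣≡1+∣p∣ (false ∷ p) (suc x) x∉p = ∣p∪⁅x⁆∣≡1+∣p∣ p x (x∉p ∘ there)
∣p∪⁅x⁆∣≡1+∣p∣ (true  ∷ p) (suc x) x∉p = cong 1+ (∣p∪⁅x⁆∣≡1+∣p∣ p x (x∉p ∘ there))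

p∪⁅x⁆-x≡p : (p : Subset m) (x : Fin m) → x ∉ p → (p ∪ ⁅ x ⁆) - x ≡ p
p∪⁅x⁆-x≡p (false ∷ p) zero    _   = cong (false ∷_) (trans (p─⊥≡p (p ∪ ∅)) (∪-identityʳ p))
p∪⁅x⁆-x≡p (true  ∷ p) zero    x∉p = ⊥-elim (x∉p here)
p∪⁅x⁆-x≡p (false ∷ p) (suc x) x∉p = cong (false ∷_) (p∪⁅x⁆-x≡p p x (x∉p ∘ there))
p∪⁅x⁆-x≡p (true  ∷ p) (suc x) x∉p = cong (true ∷_) (p∪⁅x⁆-x≡p p x (x∉p ∘ there))

p-x∪⁅x⁆≡p : (p : Subset m) (x : Fin m) → x ∈ p → (p - x) ∪ ⁅ x ⁆ ≡ p
p-x∪⁅x⁆≡p (true  ∷ p) zero    here       = cong (true ∷_) (trans (∪-identityʳ (p ─ ∅)) (p─⊥≡p p))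
p-x∪⁅x⁆≡p (false ∷ p) (suc x) (there x∈) = cong (false ∷_) (p-x∪⁅x⁆≡p p x x∈)
p-x∪⁅x⁆≡p (true  ∷ p) (suc x) (there x∈) = cong (true ∷_) (p-x∪⁅x⁆≡p p x x∈)

unmove : {p q r t : Subset m} {x : Fin m} → x ∉ p → x ∈ q → p ∪ ⁅ x ⁆ ≡ r → q - x ≡ t →
         p ≡ r - x × q ≡ t ∪ ⁅ x ⁆
unmove {p = p} {q} {x = x} x∉p x∈q refl refl = sym (p∪⁅x⁆-x≡p p x x∉p) , sym (p-x∪⁅x⁆≡p q x x∈q)

-- Pigeonhole principle for subsets: a map injective on X and sending X into
-- Y shows |X| ≤ |Y|.  Induction on X, removing the image of its first element from Y.
injection-size : ∀ {m′} (X : Subset m) (Y : Subset m′) (f : Fin m → Fin m′) →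
                 (∀ x → x ∈ X → f x ∈ Y) →
                 (∀ x y → x ∈ X → y ∈ X → f x ≡ f y → x ≡ y) →
                 ∣ X ∣ ≤ ∣ Y ∣
injection-size []          Y f maps inj = z≤n
injection-size (false ∷ X) Y f maps inj =
  injection-size X Y (f ∘ suc) (λ x x∈ → maps (suc x) (there x∈)) (λ x y x∈ y∈ → inj-suc x y x∈ y∈)
  where
  inj-suc : ∀ x y → x ∈ X → y ∈ X → f (suc x) ≡ f (suc y) → x ≡ y
  inj-suc x y x∈ y∈ e = suc-injective (inj (suc x) (suc y) (there x∈) (there y∈) e)
injection-size (true ∷ X) Y f maps inj =
  ≤-trans (s≤s (injection-size X (Y - f zero) (f ∘ suc) maps-rest inj-suc)) (x∈p⇒∣p-x∣<∣p∣ (maps zero here))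
  where
  inj-suc : ∀ x y → x ∈ X → y ∈ X → f (suc x) ≡ f (suc y) → x ≡ y
  inj-suc x y x∈ y∈ e = suc-injective (inj (suc x) (suc y) (there x∈) (there y∈) e)
  maps-rest : ∀ x → x ∈ X → f (suc x) ∈ Y - f zero
  maps-rest x x∈ = x∈p∧x≢y⇒x∈p-y (maps (suc x) (there x∈))
                     (λ e → 0≢1+n (inj zero (suc x) here (there x∈) (sym e)))

index : (X : Subset m) {v : Fin m} → v ∈ X → Fin ∣ X ∣
index (true  ∷ X) here      = zero
index (true  ∷ X) (there p) = suc (index X p)
index (false ∷ X) (there p) = index X p

index-injective : (X : Subset m) {u v : Fin m} (p : u ∈ X) (q : v ∈ X) →
                  index X p ≡ index X q → u ≡ v
index-injective (true  ∷ X) here      here      _ = refl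
index-injective (true  ∷ X) (there p) (there q) e = cong suc (index-injective X p q (suc-injective e))
index-injective (false ∷ X) (there p) (there q) e = cong suc (index-injective X p q e)

constant-or-witness : (Y : Subset m) (r : Fin m → Bool) (b : Bool) →
                      (∀ y → y ∈ Y → r y ≡ b) ⊎ (∃ λ y → y ∈ Y × r y ≡ not b)
constant-or-witness Y r b with any? (λ y → y ∈? Y ×-dec r y ≟ᵇ not b)
... | yes witness = inj₂ witness
... | no ¬witness = inj₁ λ y y∈Y → trans (¬-not (λ e → ¬witness (y , y∈Y , e))) (not-involutive b)

alternative : (X Y : Subset m) (R : Fin m → Fin m → Bool) (b : Bool) →
              (∃ λ x → x ∈ X × ∀ y → y ∈ Y → R x y ≡ b) ⊎
              (∀ x → x ∈ X → ∃ λ y → y ∈ Y × R x y ≡ not b)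
alternative X Y R b with any? (λ x → x ∈? X ×-dec all? (λ y → y ∈? Y →-dec R x y ≟ᵇ b))
... | yes witness = inj₁ witness
... | no ¬witness = inj₂ λ x x∈X →
  [ (λ constant → ⊥-elim (¬witness (x , x∈X , constant))) , id ]′ (constant-or-witness Y (R x) b)

IsPartition : Subset m → Subset m → Set
IsPartition P Q = (∀ v → v ∈ P ⊎ v ∈ Q) × (∀ v → v ∈ P → v ∈ Q → ⊥)

swap-partition : {P Q : Subset m} → IsPartition P Q → IsPartition Q P
swap-partition (cover , disjoint) = ⊎-swap ∘ cover , λ v v∈Q v∈P → disjoint v v∈P v∈Q

shift : {P Q : Subset m} (x : Fin m) → IsPartition P Q → IsPartition (P ∪ ⁅ x ⁆) (Q - x)
shift {P = P} {Q} x (cover , disjoint) = cover′ , disjoint′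
  where
  cover′ : ∀ v → v ∈ P ∪ ⁅ x ⁆ ⊎ v ∈ Q - x
  cover′ v with v ≟ x
  ... | yes refl = inj₁ (x∈p∪q⁺ (inj₂ (x∈⁅x⁆ x)))
  ... | no v≢x   = ⊎-map (λ v∈P → x∈p∪q⁺ (inj₁ v∈P)) (λ v∈Q → x∈p∧x≢y⇒x∈p-y v∈Q v≢x) (cover v)
  disjoint′ : ∀ v → v ∈ P ∪ ⁅ x ⁆ → v ∈ Q - x → ⊥
  disjoint′ v v∈P′ v∈Q′ with x∈p∪q⁻ P ⁅ x ⁆ v∈P′
  ... | inj₁ v∈P = disjoint v v∈P (p─q⊆p Q ⁅ x ⁆ v∈Q′)
  ... | inj₂ v∈x = x∈p-y⇒x≢y Q v∈Q′ (x∈⁅y⁆⇒x≡y x v∈x)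

partition-unique : {K S P Q : Subset m} → (∀ v → v ∈ K ⊎ v ∈ S) → K ⊆ P → S ⊆ Q →
                   (∀ v → v ∈ P → v ∈ Q → ⊥) → K ≡ P × S ≡ Q
partition-unique {K = K} {S} {P} {Q} cover K⊆P S⊆Q disjoint = ⊆-antisym K⊆P P⊆K , ⊆-antisym S⊆Q Q⊆S
  where
  P⊆K : P ⊆ K
  P⊆K {v} v∈P = [ id , (λ v∈S → ⊥-elim (disjoint v v∈P (S⊆Q v∈S))) ] (cover v)
  Q⊆S : Q ⊆ S
  Q⊆S {v} v∈Q = [ (λ v∈K → ⊥-elim (disjoint v (K⊆P v∈K) v∈Q)) , id ] (cover v)

module _ (G : Graph) where

  private
    Vertex = Fin (n G)
    VSet   = Subset (n G)

  N : Vertex → VSet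
  N v = tabulate (adj G v)

  SeesAll : VSet → Vertex → Set
  SeesAll K v = ∀ u → u ∈ K → adj G v u ≡ true

  SeesNone : VSet → Vertex → Set
  SeesNone S v = ∀ s → s ∈ S → adj G v s ≡ false

  ∈N⁺ : ∀ {v u} → adj G v u ≡ true → u ∈ N v
  ∈N⁺ {v} = ∈-tabulate⁺ (adj G v)

  ∈N⁻ : ∀ {v u} → u ∈ N v → adj G v u ≡ true
  ∈N⁻ {v} = ∈-tabulate⁻ (adj G v)

  v∉N[v] : ∀ v → v ∉ N v
  v∉N[v] v v∈N = true≢false (trans (sym (∈N⁻ v∈N)) (adj-irrefl G v))

  clique-∪ : ∀ {K s} → IsClique G K → SeesAll K s → IsClique G (K ∪ ⁅ s ⁆)
  clique-∪ {K} {s} clique s→K u v u∈ v∈ u≢v with x∈p∪q⁻ K ⁅ s ⁆ u∈ | x∈p∪q⁻ K ⁅ s ⁆ v∈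
  ... | inj₁ u∈K | inj₁ v∈K = clique u v u∈K v∈K u≢v
  ... | inj₁ u∈K | inj₂ v∈s rewrite x∈⁅y⁆⇒x≡y s v∈s = trans (adj-sym G u s) (s→K u u∈K)
  ... | inj₂ u∈s | inj₁ v∈K rewrite x∈⁅y⁆⇒x≡y s u∈s = s→K v v∈K
  ... | inj₂ u∈s | inj₂ v∈s = ⊥-elim (u≢v (trans (x∈⁅y⁆⇒x≡y s u∈s) (sym (x∈⁅y⁆⇒x≡y s v∈s))))

  stable-∪ : ∀ {S u} → IsStable G S → SeesNone S u → IsStable G (S ∪ ⁅ u ⁆)
  stable-∪ {S} {u} stable u↛S x y x∈ y∈ with x∈p∪q⁻ S ⁅ u ⁆ x∈ | x∈p∪q⁻ S ⁅ u ⁆ y∈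
  ... | inj₁ x∈S | inj₁ y∈S = stable x y x∈S y∈S
  ... | inj₁ x∈S | inj₂ y∈u rewrite x∈⁅y⁆⇒x≡y u y∈u = trans (adj-sym G x u) (u↛S x x∈S)
  ... | inj₂ x∈u | inj₁ y∈S rewrite x∈⁅y⁆⇒x≡y u x∈u = u↛S y y∈S
  ... | inj₂ x∈u | inj₂ y∈u rewrite x∈⁅y⁆⇒x≡y u x∈u | x∈⁅y⁆⇒x≡y u y∈u = adj-irrefl G u

  move-in : ∀ {K S s} → IsKSPartition G K S → SeesAll K s → IsKSPartition G (K ∪ ⁅ s ⁆) (S - s)
  move-in {S = S} {s} (cover , disjoint , clique , stable) s→K with shift s (cover , disjoint)
  ... | cover′ , disjoint′ = cover′ , disjoint′ , clique-∪ clique s→K ,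
        λ x y x∈ y∈ → stable x y (p─q⊆p S ⁅ s ⁆ x∈) (p─q⊆p S ⁅ s ⁆ y∈)

  move-out : ∀ {K S u} → IsKSPartition G K S → SeesNone S u → IsKSPartition G (K - u) (S ∪ ⁅ u ⁆)
  move-out {K = K} {u = u} (cover , disjoint , clique , stable) u↛S
    with swap-partition (shift u (swap-partition (cover , disjoint)))
  ... | cover′ , disjoint′ = cover′ , disjoint′ ,
        (λ x y x∈ y∈ → clique x y (p─q⊆p K ⁅ u ⁆ x∈) (p─q⊆p K ⁅ u ⁆ y∈)) , stable-∪ stable u↛S

  stable-sees-none : ∀ {S s} → IsStable G S → s ∈ S → SeesNone S s
  stable-sees-none stable s∈S t t∈S = stable _ t s∈S t∈S

  nbhd⊆K : ∀ {K S v} → IsKSPartition G K S → SeesNone S v → N v ⊆ K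
  nbhd⊆K (cover , _) v↛S {u} u∈N with cover u
  ... | inj₁ u∈K = u∈K
  ... | inj₂ u∈S = ⊥-elim (true≢false (trans (sym (∈N⁻ u∈N)) (v↛S u u∈S)))

  clique⊆closed-nbhd : ∀ {K u} → IsClique G K → u ∈ K → K ⊆ N u ∪ ⁅ u ⁆
  clique⊆closed-nbhd {u = u} clique u∈K {v} v∈K with v ≟ u
  ... | yes refl = x∈p∪q⁺ (inj₂ (x∈⁅x⁆ u))
  ... | no v≢u   = x∈p∪q⁺ (inj₁ (∈N⁺ (clique u v u∈K v∈K (v≢u ∘ sym))))

  ∣closed-nbhd∣ : ∀ u → ∣ N u ∪ ⁅ u ⁆ ∣ ≡ 1+ (deg G u)
  ∣closed-nbhd∣ u = ∣p∪⁅x⁆∣≡1+∣p∣ (N u) u (v∉N[v] u)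

  -- Degree bounds for a KS-partition (K, S).  A vertex of K sees K minus
  -- itself, plus its neighbours in S; a vertex of S sees only vertices of K.
  clique-deg : ∀ {K u} → IsClique G K → u ∈ K → ∣ K ∣ ≤ 1+ (deg G u)
  clique-deg clique u∈K =
    ≤-trans (p⊆q⇒∣p∣≤∣q∣ (clique⊆closed-nbhd clique u∈K)) (≤-reflexive (∣closed-nbhd∣ _))

  clique-deg-neighbour : ∀ {K S u s} → IsKSPartition G K S → u ∈ K → s ∈ S → adj G u s ≡ true →
                         ∣ K ∣ ≤ deg G u
  clique-deg-neighbour (_ , disjoint , clique , _) u∈K s∈S u~s = ≤-pred (≤-trans
    (p⊂q⇒∣p∣<∣q∣ (clique⊆closed-nbhd clique u∈K , _ , x∈p∪q⁺ (inj₁ (∈N⁺ u~s)) , λ s∈K → disjoint _ s∈K s∈S))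
    (≤-reflexive (∣closed-nbhd∣ _)))

  clique-deg-isolated : ∀ {K S u} → IsKSPartition G K S → u ∈ K → SeesNone S u → 1+ (deg G u) ≤ ∣ K ∣
  clique-deg-isolated P u∈K u↛S = p⊂q⇒∣p∣<∣q∣ (nbhd⊆K P u↛S , _ , u∈K , v∉N[v] _)

  stable-deg : ∀ {K S s} → IsKSPartition G K S → s ∈ S → deg G s ≤ ∣ K ∣
  stable-deg P@(_ , _ , _ , stable) s∈S = p⊆q⇒∣p∣≤∣q∣ (nbhd⊆K P (stable-sees-none stable s∈S))

  stable-deg-missing : ∀ {K S s u} → IsKSPartition G K S → s ∈ S → u ∈ K → adj G s u ≡ false →
                       1+ (deg G s) ≤ ∣ K ∣
  stable-deg-missing P@(_ , _ , _ , stable) s∈S u∈K s≁u =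
    p⊂q⇒∣p∣<∣q∣ (nbhd⊆K P (stable-sees-none stable s∈S) , _ , u∈K , λ u∈N → true≢false (trans (sym (∈N⁻ u∈N)) s≁u))

  sees-all-deg : ∀ {K s} → SeesAll K s → ∣ K ∣ ≤ deg G s
  sees-all-deg s→K = p⊆q⇒∣p∣≤∣q∣ (λ u∈K → ∈N⁺ (s→K _ u∈K))

  -- These characterise the
  -- K-max and S-max partitions (see CliqueMax and StableMax below).
  KSaturated : VSet → VSet → Set
  KSaturated K S = ∀ s → s ∈ S → ∃ λ u → u ∈ K × adj G s u ≡ false

  SSaturated : VSet → VSet → Set
  SSaturated K S = ∀ u → u ∈ K → ∃ λ s → s ∈ S × adj G u s ≡ true

  extendable-or-ksaturated : ∀ K S → (∃ λ s → s ∈ S × SeesAll K s) ⊎ KSaturated K S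
  extendable-or-ksaturated K S = alternative S K (adj G) true

  shrinkable-or-ssaturated : ∀ K S → (∃ λ u → u ∈ K × SeesNone S u) ⊎ SSaturated K S
  shrinkable-or-ssaturated K S = alternative K S (adj G) false

  -- After a move, the moved vertex itself blocks every further move back.
  move-in-ksaturated : ∀ {K S s} → IsKSPartition G K S → s ∈ S → KSaturated (K ∪ ⁅ s ⁆) (S - s)
  move-in-ksaturated {S = S} {s} (_ , _ , _ , stable) s∈S t t∈S′ =
    s , x∈p∪q⁺ (inj₂ (x∈⁅x⁆ s)) , stable t s (p─q⊆p S ⁅ s ⁆ t∈S′) s∈S

  move-out-ssaturated : ∀ {K S u} → IsKSPartition G K S → u ∈ K → SSaturated (K - u) (S ∪ ⁅ u ⁆)
  move-out-ssaturated {K = K} {u = u} (_ , _ , clique , _) u∈K v v∈K′ =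
    u , x∈p∪q⁺ (inj₂ (x∈⁅x⁆ u)) , clique v u (p─q⊆p K ⁅ u ⁆ v∈K′) u∈K (x∈p-y⇒x≢y K v∈K′)

  -- For a K-saturated partition every clique X is at most as large as K:
  -- send the vertices of X ∩ K to themselves and the (at most one) vertex of
  -- X ∩ S to one of its non-neighbours in K.
  clique-bound : ∀ {K S X} → IsKSPartition G K S → KSaturated K S → IsClique G X → ∣ X ∣ ≤ ∣ K ∣
  clique-bound {K} {S} {X} (cover , disjoint , _ , stable) sat X-clique = injection-size X K f f∈K f-inj
    where
    image : ∀ v → v ∈ K ⊎ v ∈ S → Vertex
    image v (inj₁ _)   = v
    image v (inj₂ v∈S) = proj₁ (sat v v∈S)
    f : Vertex → Vertex
    f v = image v (cover v)
    f∈K : ∀ v → v ∈ X → f v ∈ K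
    f∈K v _ with cover v
    ... | inj₁ v∈K = v∈K
    ... | inj₂ v∈S = proj₁ (proj₂ (sat v v∈S))
    missed∉X : ∀ v (v∈S : v ∈ S) → v ∈ X → proj₁ (sat v v∈S) ∉ X
    missed∉X v v∈S v∈X u∈X with sat v v∈S
    ... | u , u∈K , v≁u = true≢false (trans (sym (X-clique v u v∈X u∈X (λ { refl → disjoint v u∈K v∈S }))) v≁u)
    f-inj : ∀ u v → u ∈ X → v ∈ X → f u ≡ f v → u ≡ v
    f-inj u v u∈X v∈X fu≡fv with cover u | cover v
    ... | inj₁ _   | inj₁ _   = fu≡fv
    ... | inj₁ _   | inj₂ v∈S = ⊥-elim (missed∉X v v∈S v∈X (subst (_∈ X) fu≡fv u∈X))
    ... | inj₂ u∈S | inj₁ _   = ⊥-elim (missed∉X u u∈S u∈X (subst (_∈ X) (sym fu≡fv) v∈X))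
    ... | inj₂ u∈S | inj₂ v∈S with u ≟ v
    ...   | yes u≡v = u≡v
    ...   | no u≢v  = ⊥-elim (true≢false (trans (sym (X-clique u v u∈X v∈X u≢v)) (stable u v u∈S v∈S)))

  stable-bound : ∀ {K S Y} → IsKSPartition G K S → SSaturated K S → IsStable G Y → ∣ Y ∣ ≤ ∣ S ∣
  stable-bound {K} {S} {Y} (cover , disjoint , clique , _) sat Y-stable = injection-size Y S f f∈S f-inj
    where
    image : ∀ v → v ∈ K ⊎ v ∈ S → Vertex
    image v (inj₁ v∈K) = proj₁ (sat v v∈K)
    image v (inj₂ _)   = v
    f : Vertex → Vertex
    f v = image v (cover v)
    f∈S : ∀ v → v ∈ Y → f v ∈ S
    f∈S v _ with cover v
    ... | inj₁ v∈K = proj₁ (proj₂ (sat v v∈K))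
    ... | inj₂ v∈S = v∈S
    hit∉Y : ∀ v (v∈K : v ∈ K) → v ∈ Y → proj₁ (sat v v∈K) ∉ Y
    hit∉Y v v∈K v∈Y h∈Y with sat v v∈K
    ... | h , _ , v~h = true≢false (trans (sym v~h) (Y-stable v h v∈Y h∈Y))
    f-inj : ∀ u v → u ∈ Y → v ∈ Y → f u ≡ f v → u ≡ v
    f-inj u v u∈Y v∈Y fu≡fv with cover u | cover v
    ... | inj₂ _   | inj₂ _   = fu≡fv
    ... | inj₁ u∈K | inj₂ _   = ⊥-elim (hit∉Y u u∈K u∈Y (subst (_∈ Y) (sym fu≡fv) v∈Y))
    ... | inj₂ _   | inj₁ v∈K = ⊥-elim (hit∉Y v v∈K v∈Y (subst (_∈ Y) fu≡fv u∈Y))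
    ... | inj₁ u∈K | inj₁ v∈K with u ≟ v
    ...   | yes u≡v = u≡v
    ...   | no u≢v  = ⊥-elim (true≢false (trans (sym (clique u v u∈K v∈K u≢v)) (Y-stable u v u∈Y v∈Y)))

  -- A K-saturated split graph is |K|-colourable: the vertices of K get
  -- distinct colours and each vertex of S the colour of a non-neighbour in K.
  split-colouring : ∀ {K S} → IsKSPartition G K S → KSaturated K S → Colorable G ∣ K ∣
  split-colouring {K} {S} (cover , disjoint , _ , stable) sat = colour , proper
    where
    colour : Vertex → Fin ∣ K ∣
    colour v with cover v
    ... | inj₁ v∈K = index K v∈K
    ... | inj₂ v∈S = index K (proj₁ (proj₂ (sat v v∈S)))
    borrowed-not-adjacent : ∀ u v → (v∈S : v ∈ S) → adj G u v ≡ true → u ≢ proj₁ (sat v v∈S)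
    borrowed-not-adjacent u v v∈S u~v with sat v v∈S
    ... | _ , _ , v≁u = λ { refl → true≢false (trans (sym (trans (adj-sym G v u) u~v)) v≁u) }
    proper : ∀ u v → adj G u v ≡ true → colour u ≢ colour v
    proper u v u~v same with cover u | cover v
    ... | inj₁ u∈K | inj₁ v∈K = v∉N[v] u (subst (_∈ N u) (sym (index-injective K u∈K v∈K same)) (∈N⁺ u~v))
    ... | inj₁ u∈K | inj₂ v∈S = borrowed-not-adjacent u v v∈S u~v (index-injective K u∈K _ same)
    ... | inj₂ u∈S | inj₁ v∈K =
      borrowed-not-adjacent v u u∈S (trans (adj-sym G v u) u~v) (index-injective K v∈K _ (sym same))
    ... | inj₂ u∈S | inj₂ v∈S = true≢false (trans (sym u~v) (stable u v u∈S v∈S))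

  -- A proper j-colouring is injective on every clique, so cliques have at most j vertices.
  colouring-bound : ∀ {j X} → Colorable G j → IsClique G X → ∣ X ∣ ≤ j
  colouring-bound {j} {X} (c , proper) X-clique =
    ≤-trans (injection-size X ⊤ c (λ _ _ → ∈⊤) c-inj) (≤-reflexive (∣⊤∣≡n j))
    where
    c-inj : ∀ u v → u ∈ X → v ∈ X → c u ≡ c v → u ≡ v
    c-inj u v u∈X v∈X cu≡cv with u ≟ v
    ... | yes u≡v = u≡v
    ... | no u≢v  = ⊥-elim (proper u v (X-clique u v u∈X v∈X u≢v) cu≡cv)

module CliqueMax (G : Graph) {w : ℕ} (ω : IsCliqueNumber G w) where

  kmax-if-ksaturated : ∀ {K S} → IsKSPartition G K S → KSaturated G K S → KMax G w K S
  kmax-if-ksaturated P@(_ , _ , clique , _) sat with proj₁ ω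
  ... | X , X-clique , ∣X∣≡w =
    P , ≤-antisym (proj₂ ω _ clique) (subst (_≤ _) ∣X∣≡w (clique-bound G P sat X-clique))

  -- A vertex of S adjacent to all of K would give a clique of size w + 1.
  kmax-ksaturated : ∀ {K S} → KMax G w K S → KSaturated G K S
  kmax-ksaturated {K} {S} (P@(_ , disjoint , clique , _) , ∣K∣≡w) s s∈S
    with constant-or-witness K (adj G s) true
  ... | inj₂ missed = missed
  ... | inj₁ s→K = ⊥-elim (<-irrefl refl (≤-trans larger (proj₂ ω _ (clique-∪ G clique s→K))))
    where
    larger : 1+ w ≤ ∣ K ∪ ⁅ s ⁆ ∣
    larger = ≤-reflexive (trans (cong 1+ (sym ∣K∣≡w)) (sym (∣p∪⁅x⁆∣≡1+∣p∣ K s (λ s∈K → disjoint s s∈K s∈S))))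

  move-in-kmax : ∀ {K S s} → IsKSPartition G K S → s ∈ S → SeesAll G K s → KMax G w (K ∪ ⁅ s ⁆) (S - s)
  move-in-kmax P s∈S s→K = kmax-if-ksaturated (move-in G P s→K) (move-in-ksaturated G P s∈S)

  kmax-exists : IsSplit G → ∃ λ K → ∃ λ S → KMax G w K S
  kmax-exists (K , S , P) with extendable-or-ksaturated G K S
  ... | inj₁ (s , s∈S , s→K) = _ , _ , move-in-kmax P s∈S s→K
  ... | inj₂ sat             = K , S , kmax-if-ksaturated P sat

module StableMax (G : Graph) {a : ℕ} (α : IsIndependenceNumber G a) where

  smax-if-ssaturated : ∀ {K S} → IsKSPartition G K S → SSaturated G K S → SMax G a K S
  smax-if-ssaturated P@(_ , _ , _ , stable) sat with proj₁ α
  ... | Y , Y-stable , ∣Y∣≡a =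
    P , ≤-antisym (proj₂ α _ stable) (subst (_≤ _) ∣Y∣≡a (stable-bound G P sat Y-stable))

  -- A vertex of K adjacent to none of S would give a stable set of size a + 1.
  smax-ssaturated : ∀ {K S} → SMax G a K S → SSaturated G K S
  smax-ssaturated {K} {S} (P@(_ , disjoint , _ , stable) , ∣S∣≡a) u u∈K
    with constant-or-witness S (adj G u) false
  ... | inj₂ hit = hit
  ... | inj₁ u↛S = ⊥-elim (<-irrefl refl (≤-trans larger (proj₂ α _ (stable-∪ G stable u↛S))))
    where
    larger : 1+ a ≤ ∣ S ∪ ⁅ u ⁆ ∣
    larger = ≤-reflexive (trans (cong 1+ (sym ∣S∣≡a)) (sym (∣p∪⁅x⁆∣≡1+∣p∣ S u (disjoint u u∈K))))

  move-out-smax : ∀ {K S u} → IsKSPartition G K S → u ∈ K → SeesNone G S u → SMax G a (K - u) (S ∪ ⁅ u ⁆)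
  move-out-smax P u∈K u↛S = smax-if-ssaturated (move-out G P u↛S) (move-out-ssaturated G P u∈K)

  smax-exists : IsSplit G → ∃ λ K → ∃ λ S → SMax G a K S
  smax-exists (K , S , P) with shrinkable-or-ssaturated G K S
  ... | inj₁ (u , u∈K , u↛S) = _ , _ , move-out-smax P u∈K u↛S
  ... | inj₂ sat             = K , S , smax-if-ssaturated P sat

chromatic≡clique : (G : Graph) {k w : ℕ} → IsSplit G → IsChromaticNumber G k → IsCliqueNumber G w → k ≡ w
chromatic≡clique G {k} {w} split (k-colourable , k-least) ω with CliqueMax.kmax-exists G ω split | proj₁ ω
... | K , S , km@(P , ∣K∣≡w) | X , X-clique , ∣X∣≡w =
  ≤-antisym (k-least w (subst (Colorable G) ∣K∣≡w (split-colouring G P (CliqueMax.kmax-ksaturated G ω km))))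
            (subst (_≤ k) ∣X∣≡w (colouring-bound G k-colourable X-clique))

-- In an unbalanced split graph no partition is both K-max and S-max, so the
-- extremal partitions always admit a move.
module Unbalanced (G : Graph) {w a : ℕ} (ω : IsCliqueNumber G w) (α : IsIndependenceNumber G a)
                  (unbalanced : IsUnbalanced G w a) where
  open CliqueMax G ω
  open StableMax G α

  kmax-shrinkable : ∀ {K S} → KMax G w K S → ∃ λ u → u ∈ K × SeesNone G S u
  kmax-shrinkable {K} {S} km with shrinkable-or-ssaturated G K S
  ... | inj₁ shrinkable = shrinkable
  ... | inj₂ sat        = ⊥-elim (proj₂ unbalanced (K , S , km , smax-if-ssaturated (proj₁ km) sat))

  smax-extendable : ∀ {K S} → SMax G a K S → ∃ λ s → s ∈ S × SeesAll G K s
  smax-extendable {K} {S} sm with extendable-or-ksaturated G K S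
  ... | inj₁ extendable = extendable
  ... | inj₂ sat        = ⊥-elim (proj₂ unbalanced (K , S , kmax-if-ksaturated (proj₁ sm) sat , sm))

  smax-clique-size : ∀ {K S} → SMax G a K S → w ≡ 1+ ∣ K ∣
  smax-clique-size {K} sm@(P@(_ , disjoint , _ , _) , _) with smax-extendable sm
  ... | s , s∈S , s→K =
    trans (sym (proj₂ (move-in-kmax P s∈S s→K))) (∣p∪⁅x⁆∣≡1+∣p∣ K s (λ s∈K → disjoint s s∈K s∈S))

  clique-number-positive : ∃ λ d → w ≡ 1+ d
  clique-number-positive with smax-exists (proj₁ unbalanced)
  ... | K , _ , sm = ∣ K ∣ , smax-clique-size sm

-- The ABC-partition for χ(G) = d + 1: A, B, C are the vertices of degree
-- equal to, above and below d.
module DegreeClasses (G : Graph) (d : ℕ) where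

  A B C : Subset (n G)
  A = setA G (1+ d)
  B = setB G (1+ d)
  C = setC G (1+ d)

  A⁺ : ∀ {v} → deg G v ≡ d → v ∈ A
  A⁺ = ∈-decided⁺ (λ v → deg G v ≟ℕ d)
  A⁻ : ∀ {v} → v ∈ A → deg G v ≡ d
  A⁻ = ∈-decided⁻ (λ v → deg G v ≟ℕ d)
  B⁺ : ∀ {v} → d < deg G v → v ∈ B
  B⁺ = ∈-decided⁺ (λ v → d <?ℕ deg G v)
  B⁻ : ∀ {v} → v ∈ B → d < deg G v
  B⁻ = ∈-decided⁻ (λ v → d <?ℕ deg G v)
  C⁺ : ∀ {v} → deg G v < d → v ∈ C
  C⁺ = ∈-decided⁺ (λ v → deg G v <?ℕ d)
  C⁻ : ∀ {v} → v ∈ C → deg G v < d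
  C⁻ = ∈-decided⁻ (λ v → deg G v <?ℕ d)

  A∪B⁺ : ∀ {v} → d ≤ deg G v → v ∈ A ∪ B
  A∪B⁺ d≤deg with m≤n⇒m<n∨m≡n d≤deg
  ... | inj₁ d<deg = x∈p∪q⁺ (inj₂ (B⁺ d<deg))
  ... | inj₂ d≡deg = x∈p∪q⁺ (inj₁ (A⁺ (sym d≡deg)))

  A∪B⁻ : ∀ {v} → v ∈ A ∪ B → d ≤ deg G v
  A∪B⁻ v∈ with x∈p∪q⁻ A B v∈
  ... | inj₁ v∈A = ≤-reflexive (sym (A⁻ v∈A))
  ... | inj₂ v∈B = <⇒≤ (B⁻ v∈B)

  A∪C⁺ : ∀ {v} → deg G v ≤ d → v ∈ A ∪ C
  A∪C⁺ deg≤d with m≤n⇒m<n∨m≡n deg≤d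
  ... | inj₁ deg<d = x∈p∪q⁺ (inj₂ (C⁺ deg<d))
  ... | inj₂ deg≡d = x∈p∪q⁺ (inj₁ (A⁺ deg≡d))

  A∪C⁻ : ∀ {v} → v ∈ A ∪ C → deg G v ≤ d
  A∪C⁻ v∈ with x∈p∪q⁻ A C v∈
  ... | inj₁ v∈A = ≤-reflexive (A⁻ v∈A)
  ... | inj₂ v∈C = <⇒≤ (C⁻ v∈C)

module NG1 (G : Graph) {d a : ℕ} (ω : IsCliqueNumber G (1+ d)) (α : IsIndependenceNumber G a)
           (unbalanced : IsUnbalanced G (1+ d) a) (A-clique : IsClique G (setA G (1+ d))) where
  open DegreeClasses G d
  open CliqueMax G ω
  open StableMax G α
  open Unbalanced G ω α unbalanced

  -- Vertices of K have degree ≥ d,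
  -- vertices of S degree ≤ d; a vertex of S of degree exactly d would lie in
  -- A together with a vertex of K without neighbours in S, which is adjacent
  -- to it because A is a clique.
  kmax-shape : ∀ {K S} → KMax G (1+ d) K S → K ≡ A ∪ B × S ≡ C
  kmax-shape {K} {S} km@(P@(cover , disjoint , clique , _) , ∣K∣≡) =
    partition-unique cover (λ u∈K → A∪B⁺ (high u∈K)) S⊆C (λ v v∈AB v∈C → <⇒≱ (C⁻ v∈C) (A∪B⁻ v∈AB))
    where
    high : ∀ {u} → u ∈ K → d ≤ deg G u
    high u∈K = ≤-pred (subst (_≤ _) ∣K∣≡ (clique-deg G clique u∈K))
    isolated∈A : ∀ {u} → u ∈ K → SeesNone G S u → u ∈ A
    isolated∈A u∈K u↛S = A⁺ (≤-antisym (≤-pred (subst (_ ≤_) ∣K∣≡ (clique-deg-isolated G P u∈K u↛S))) (high u∈K))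
    S⊆C : ∀ {s} → s ∈ S → s ∈ C
    S⊆C {s} s∈S with kmax-ksaturated km s s∈S
    ... | u , u∈K , s≁u with m≤n⇒m<n∨m≡n (≤-pred (subst (_ ≤_) ∣K∣≡ (stable-deg-missing G P s∈S u∈K s≁u)))
    ...   | inj₁ deg<d = C⁺ deg<d
    ...   | inj₂ deg≡d with kmax-shrinkable km
    ...     | x , x∈K , x↛S = ⊥-elim (true≢false (trans (sym x~s) (x↛S s s∈S)))
      where
      x~s = A-clique x s (isolated∈A x∈K x↛S) (A⁺ deg≡d) (λ { refl → disjoint x x∈K s∈S })

  kmax-AB-C : KMax G (1+ d) (A ∪ B) C
  kmax-AB-C with kmax-exists (proj₁ unbalanced)
  ... | _ , _ , km with kmax-shape km
  ...   | refl , refl = km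

  -- A vertex of A has only its d clique-mates as neighbours.
  A-sees-none-of-C : ∀ {x} → x ∈ A → SeesNone G C x
  A-sees-none-of-C {x} x∈A s s∈C = ¬-not λ x~s → <-irrefl (sym (A⁻ x∈A))
    (subst (_≤ deg G x) (proj₂ kmax-AB-C) (clique-deg-neighbour G (proj₁ kmax-AB-C) (x∈p∪q⁺ (inj₁ x∈A)) s∈C x~s))

  -- A partition that is not K-max becomes K-max by moving in a vertex s of
  -- S adjacent to all of K; then |K| = d, so deg s = d and s ∈ A.
  ks-partitions : ∀ {K S} → IsKSPartition G K S →
                  (K ≡ A ∪ B × S ≡ C) ⊎ (∃ λ x → x ∈ A × K ≡ (A ∪ B) - x × S ≡ C ∪ ⁅ x ⁆)
  ks-partitions {K} {S} P@(_ , disjoint , _ , _) with extendable-or-ksaturated G K S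
  ... | inj₂ sat = inj₁ (kmax-shape (kmax-if-ksaturated P sat))
  ... | inj₁ (s , s∈S , s→K) with move-in-kmax P s∈S s→K
  ...   | km′@(_ , ∣K∪s∣≡) with kmax-shape km′
  ...     | K∪s≡AB , S-s≡C = inj₂ (s , A⁺ (≤-antisym deg≤d d≤deg) , unmove s∉K s∈S K∪s≡AB S-s≡C)
    where
    s∉K = λ s∈K → disjoint s s∈K s∈S
    deg≤d : deg G s ≤ d
    deg≤d = subst (deg G s ≤_) (1+-injective (trans (sym (∣p∪⁅x⁆∣≡1+∣p∣ K s s∉K)) ∣K∪s∣≡)) (stable-deg G P s∈S)
    d≤deg : d ≤ deg G s
    d≤deg = A∪B⁻ (subst (s ∈_) K∪s≡AB (x∈p∪q⁺ (inj₂ (x∈⁅x⁆ s))))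

  conclusion : (∀ K S → IsKSPartition G K S ⇔
                  ((K ≡ A ∪ B × S ≡ C) ⊎ (∃ λ x → x ∈ A × K ≡ (A ∪ B) - x × S ≡ C ∪ ⁅ x ⁆)))
             × KMax G (1+ d) (A ∪ B) C
             × (∀ K S → KMax G (1+ d) K S → K ≡ A ∪ B × S ≡ C)
             × (∀ x → x ∈ A → SMax G a ((A ∪ B) - x) (C ∪ ⁅ x ⁆))
  conclusion = (λ K S → mk⇔ ks-partitions realised) , kmax-AB-C , (λ K S → kmax-shape) , moved-smax
    where
    AB-C = proj₁ kmax-AB-C
    realised : ∀ {K S} → (K ≡ A ∪ B × S ≡ C) ⊎ (∃ λ x → x ∈ A × K ≡ (A ∪ B) - x × S ≡ C ∪ ⁅ x ⁆) →
               IsKSPartition G K S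
    realised (inj₁ (refl , refl))           = AB-C
    realised (inj₂ (x , x∈A , refl , refl)) = move-out G AB-C (A-sees-none-of-C x∈A)
    moved-smax : ∀ x → x ∈ A → SMax G a ((A ∪ B) - x) (C ∪ ⁅ x ⁆)
    moved-smax x x∈A = move-out-smax AB-C (x∈p∪q⁺ (inj₁ x∈A)) (A-sees-none-of-C x∈A)

module NG2 (G : Graph) {d a : ℕ} (ω : IsCliqueNumber G (1+ d)) (α : IsIndependenceNumber G a)
           (unbalanced : IsUnbalanced G (1+ d) a) (A-stable : IsStable G (setA G (1+ d))) where
  open DegreeClasses G d
  open CliqueMax G ω
  open StableMax G α
  open Unbalanced G ω α unbalanced

  smax-size : ∀ {K S} → SMax G a K S → ∣ K ∣ ≡ d
  smax-size sm = sym (1+-injective (smax-clique-size sm))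

  -- Vertices of S have degree ≤ d,
  -- vertices of K degree ≥ d; a vertex of K of degree exactly d would lie in
  -- A together with a vertex of S adjacent to all of K, which is not adjacent
  -- to it because A is stable.
  smax-shape : ∀ {K S} → SMax G a K S → K ≡ B × S ≡ A ∪ C
  smax-shape {K} {S} sm@(P@(cover , disjoint , _ , _) , _) =
    partition-unique cover K⊆B (λ s∈S → A∪C⁺ (low s∈S)) (λ v v∈B v∈AC → <⇒≱ (B⁻ v∈B) (A∪C⁻ v∈AC))
    where
    low : ∀ {s} → s ∈ S → deg G s ≤ d
    low s∈S = subst (_ ≤_) (smax-size sm) (stable-deg G P s∈S)
    extender∈A : ∀ {s} → s ∈ S → SeesAll G K s → s ∈ A
    extender∈A s∈S s→K = A⁺ (≤-antisym (low s∈S) (subst (_≤ _) (smax-size sm) (sees-all-deg G s→K)))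
    K⊆B : ∀ {u} → u ∈ K → u ∈ B
    K⊆B {u} u∈K with smax-ssaturated sm u u∈K
    ... | t , t∈S , u~t with m≤n⇒m<n∨m≡n (subst (_≤ _) (smax-size sm) (clique-deg-neighbour G P u∈K t∈S u~t))
    ...   | inj₁ d<deg = B⁺ d<deg
    ...   | inj₂ d≡deg with smax-extendable sm
    ...     | s , s∈S , s→K = ⊥-elim (true≢false (trans (sym (s→K u u∈K)) s≁u))
      where
      s≁u = A-stable s u (extender∈A s∈S s→K) (A⁺ (sym d≡deg))

  smax-B-AC : SMax G a B (A ∪ C)
  smax-B-AC with smax-exists (proj₁ unbalanced)
  ... | _ , _ , sm with smax-shape sm
  ...   | refl , refl = sm

  -- A vertex of A ⊆ S has degree d = |B|, so it is adjacent to all of B.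
  A-sees-all-of-B : ∀ {x} → x ∈ A → SeesAll G B x
  A-sees-all-of-B {x} x∈A u u∈B = ¬-not λ x≁u → <-irrefl (A⁻ x∈A)
    (subst (1+ (deg G x) ≤_) (smax-size smax-B-AC)
      (stable-deg-missing G (proj₁ smax-B-AC) (x∈p∪q⁺ (inj₁ x∈A)) u∈B x≁u))

  -- A partition that is not S-max becomes S-max by moving out a vertex u of
  -- K adjacent to none of S; then |K| = d + 1, so deg u = d and u ∈ A.
  ks-partitions : ∀ {K S} → IsKSPartition G K S →
                  (K ≡ B × S ≡ A ∪ C) ⊎ (∃ λ x → x ∈ A × K ≡ B ∪ ⁅ x ⁆ × S ≡ (A ∪ C) - x)
  ks-partitions {K} {S} P@(_ , disjoint , clique , _) with shrinkable-or-ssaturated G K S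
  ... | inj₂ sat = inj₁ (smax-shape (smax-if-ssaturated P sat))
  ... | inj₁ (u , u∈K , u↛S) with move-out-smax P u∈K u↛S
  ...   | sm′ with smax-shape sm′
  ...     | K-u≡B , S∪u≡AC with unmove (disjoint u u∈K) u∈K S∪u≡AC K-u≡B
  ...       | S≡ , K≡ = inj₂ (u , A⁺ (≤-antisym deg≤d d≤deg) , K≡ , S≡)
    where
    deg≤d : deg G u ≤ d
    deg≤d = A∪C⁻ (subst (u ∈_) S∪u≡AC (x∈p∪q⁺ (inj₂ (x∈⁅x⁆ u))))
    d≤deg : d ≤ deg G u
    d≤deg = ≤-pred (≤-trans (subst (_< ∣ K ∣) (smax-size sm′) (x∈p⇒∣p-x∣<∣p∣ u∈K)) (clique-deg G clique u∈K))

  conclusion : (∀ K S → IsKSPartition G K S ⇔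
                  ((K ≡ B × S ≡ A ∪ C) ⊎ (∃ λ x → x ∈ A × K ≡ B ∪ ⁅ x ⁆ × S ≡ (A ∪ C) - x)))
             × SMax G a B (A ∪ C)
             × (∀ K S → SMax G a K S → K ≡ B × S ≡ A ∪ C)
             × (∀ x → x ∈ A → KMax G (1+ d) (B ∪ ⁅ x ⁆) ((A ∪ C) - x))
  conclusion = (λ K S → mk⇔ ks-partitions realised) , smax-B-AC , (λ K S → smax-shape) , moved-kmax
    where
    B-AC = proj₁ smax-B-AC
    realised : ∀ {K S} → (K ≡ B × S ≡ A ∪ C) ⊎ (∃ λ x → x ∈ A × K ≡ B ∪ ⁅ x ⁆ × S ≡ (A ∪ C) - x) →
               IsKSPartition G K S
    realised (inj₁ (refl , refl))           = B-AC
    realised (inj₂ (x , x∈A , refl , refl)) = move-in G B-AC (A-sees-all-of-B x∈A)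
    moved-kmax : ∀ x → x ∈ A → KMax G (1+ d) (B ∪ ⁅ x ⁆) ((A ∪ C) - x)
    moved-kmax x x∈A = move-in-kmax B-AC (x∈p∪q⁺ (inj₁ x∈A)) (A-sees-all-of-B x∈A)

-- Theorem 2.5.  Since χ(G) = ω(G) = d + 1, the ABC-partition is the one of
-- DegreeClasses G d, and the two cases are NG1.conclusion and NG2.conclusion
-- (only the clique / stable-set property of A is needed).
theorem2p5 : (G : Graph) (k w a : ℕ)
    → IsChromaticNumber G k → IsCliqueNumber G w → IsIndependenceNumber G a
    → IsUnbalanced G w a →
      (IsNG1 G k →
          (∀ K S → IsKSPartition G K S ⇔
             ((K ≡ (setA G k) ∪ (setB G k) × S ≡ (setC G k)) ⊎
              (∃ λ x → x ∈ (setA G k) × K ≡ ((setA G k) ∪ (setB G k)) - x × S ≡ (setC G k) ∪ ⁅ x ⁆)))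
        × KMax G w ((setA G k) ∪ (setB G k)) (setC G k)
        × (∀ K S → KMax G w K S → K ≡ (setA G k) ∪ (setB G k) × S ≡ (setC G k))
        × (∀ x → x ∈ (setA G k) → SMax G a (((setA G k) ∪ (setB G k)) - x) ((setC G k) ∪ ⁅ x ⁆)))
      ×
      (IsNG2 G k →
          (∀ K S → IsKSPartition G K S ⇔
             ((K ≡ (setB G k) × S ≡ (setA G k) ∪ (setC G k)) ⊎
              (∃ λ x → x ∈ (setA G k) × K ≡ (setB G k) ∪ ⁅ x ⁆ × S ≡ ((setA G k) ∪ (setC G k)) - x)))
        × SMax G a (setB G k) ((setA G k) ∪ (setC G k))
        × (∀ K S → SMax G a K S → K ≡ (setB G k) × S ≡ (setA G k) ∪ (setC G k))
        × (∀ x → x ∈ (setA G k) → KMax G w ((setB G k) ∪ ⁅ x ⁆) (((setA G k) ∪ (setC G k)) - x)))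
theorem2p5 G k w a χ ω α unbalanced
  with chromatic≡clique G (proj₁ unbalanced) χ ω | Unbalanced.clique-number-positive G ω α unbalanced
... | refl | d , refl =
  (λ (_ , A-clique) → NG1.conclusion G ω α unbalanced A-clique) ,
  (λ (_ , A-stable) → NG2.conclusion G ω α unbalanced A-stable)
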